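{- Let $n\ge 2$, let $G$ be a connected graph on $n$ vertices, and let $e$ be an edge of the complement $\overline{G}$ (a pair of nonadjacent vertices). If $\operatorname{tr}_2(G)\leq \operatorname{tr}_2(K_{1,n-1})$, then $\operatorname{tr}_2(G+e)< \operatorname{tr}_2(K_{1,n-1})$.
   Context: For a graph $G$ with at least one edge, vertex degrees $d_1,\dots,d_n$ and degree sum $d_G=\sum_i d_i$, define \[\operatorname{tr}_2(G)=\frac{\sum_{i=1}^n d_i^2+d_G}{d_G^2},\] which equals $\operatorname{tr}(\rho(G)^2)$ where $\rho(G)=\frac{1}{\operatorname{tr}L(G)}L(G)$ is the trace-normalized combinatorial Laplacian. $G+e$ denotes the graph obtained from $G$ by adding the edge $e$; $K_{1,n-1}$ is the star on $n$ vertices. -}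

module Defs where

open import Data.Nat using (ℕ; zero; suc; _+_; _*_)
open import Data.Bool using (Bool; true; false; _∨_; _∧_; if_then_else_)
open import Data.Fin using (Fin) renaming (zero to fzero)
open import Data.Fin.Properties using (_≟_)
open import Data.List using (List; map; allFin)
open import Data.Nat.ListAction using (sum)
open import Data.Integer using (+_)
open import Data.Rational using (ℚ; _/_; 0ℚ)
open import Relation.Binary.PropositionalEquality using (_≡_)

open import Relation.Nullary.Decidable using (⌊_⌋)

Graph : ℕ → Set
Graph n = Fin n → Fin n → Bool

record IsSimple {n : ℕ} (G : Graph n) : Set where
  field
    symmetric   : ∀ i j → G i j ≡ G j i
    irreflexive : ∀ i → G i i ≡ false

data Reach {n : ℕ} (G : Graph n) : Fin n → Fin n → Set where
  here : ∀ {u} → Reach G u u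
  step : ∀ {u w v} → G u w ≡ true → Reach G w v → Reach G u v

Connected : {n : ℕ} → Graph n → Set
Connected {n} G = ∀ (u v : Fin n) → Reach G u v

sumFin : (n : ℕ) → (Fin n → ℕ) → ℕ
sumFin n f = sum (map f (allFin n))

deg : {n : ℕ} → Graph n → Fin n → ℕ
deg {n} G i = sumFin n (λ j → if G i j then 1 else 0)

degSum : {n : ℕ} → Graph n → ℕ
degSum {n} G = sumFin n (deg G)

-- tr_2(G) = (Σ d_i^2 + d_G) / d_G^2 ; only meaningful when G has an edge
-- (d_G ≠ 0); the edgeless case is given the junk value 0.
tr2 : {n : ℕ} → Graph n → ℚ
tr2 {n} G with degSum G
... | zero  = 0ℚ
... | suc k = (+ (sumFin n (λ i → deg G i * deg G i) + suc k)) / (suc k * suc k)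

addEdge : {n : ℕ} → Graph n → Fin n → Fin n → Graph n
addEdge G u v x y =
  G x y ∨ ((⌊ x ≟ u ⌋ ∧ ⌊ y ≟ v ⌋) ∨ (⌊ x ≟ v ⌋ ∧ ⌊ y ≟ u ⌋))

-- The star K_{1,n-1} on Fin n with centre 0 (n ≥ 1 written as suc m).
star : (m : ℕ) → Graph (suc m)
star m x y =
  (⌊ x ≟ fzero ⌋ ∧ Data.Bool.not ⌊ y ≟ fzero ⌋) ∨ (⌊ y ≟ fzero ⌋ ∧ Data.Bool.not ⌊ x ≟ fzero ⌋)

-- Write tr₂ G = N / D² with D = Σ dᵢ and N = Σ dᵢ² + D. Adding the non-edge uv raises D by 2 and
-- N by ΔN = 2(d_u + d_v) + 4, hence D² by ΔD² = 4D + 4. So tr₂(G + e) = (N + ΔN) / (D² + ΔD²) stays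
-- strictly below tr₂(K_{1,n-1}) = P / Q once N / D² ≤ P / Q and ΔN / ΔD² < P / Q. The latter needs
-- only 2(d_u + d_v) ≤ D, as u and v are nonadjacent, and D ≥ n, as a connected graph on n ≥ 2
-- vertices has no isolated vertex.
module Submission where

open import Data.Bool using (Bool; true; false; if_then_else_; _∨_)
open import Data.Empty using (⊥-elim)
open import Data.Fin using (Fin; zero; suc)
import Data.Integer as ℤ
open import Data.Integer.Properties using (pos-*; drop‿+≤+)
open import Data.Fin.Properties using (_≟_)
open import Data.List using (tabulate)
open import Data.List.Properties using (map-tabulate)
import Data.Nat.ListAction as List
open import Data.Nat using (ℕ; zero; suc; pred; _+_; _*_; _≤_; _<_; z≤n; z<s; NonZero; >-nonZero)
open import Data.Nat.Properties hiding (_≟_)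
open import Algebra.Properties.Semiring.Sum +-*-semiring
  using (sum; sum-syntax; sum-cong-≗; ∑-distrib-+; sum-replicate-zero; *-distribˡ-sum)
open import Data.Rational as ℚ using (_/_)
open import Data.Rational.Properties using (toℚᵘ-mono-≤; toℚᵘ-cancel-<; toℚᵘ-fromℚᵘ)
open import Data.Rational.Unnormalised using (mkℚᵘ; *≤*; *<*)
open import Data.Rational.Unnormalised.Properties using (≤-respˡ-≃; ≤-respʳ-≃; <-respˡ-≃; <-respʳ-≃; ≃-sym)
open import Data.Nat.Tactic.RingSolver using (solve-∀)
open import Function using (_∘_; id)
open import Data.Product using (_,_)
open import Relation.Binary.PropositionalEquality
open import Relation.Nullary using (yes; no; ¬_)
open import Relation.Nullary.Decidable using (⌊_⌋)

open import Defs

iverson : Bool → ℕ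
iverson b = if b then 1 else 0

δ : ∀ {n} → Fin n → Fin n → ℕ
δ u x = iverson ⌊ x ≟ u ⌋

δ-suc : ∀ {n} (u x : Fin n) → δ (suc u) (suc x) ≡ δ u x
δ-suc u x with x ≟ u
... | yes _ = refl
... | no _ = refl

-- The shape of adjacency-addEdge away from the new edge, where both δ-products vanish.
iverson-∨-false : ∀ b → iverson (b ∨ false) ≡ iverson b + 0 + 0
iverson-∨-false false = refl
iverson-∨-false true = refl

iverson-*-≤ : ∀ b a → iverson b * a ≤ a
iverson-*-≤ false a = z≤n
iverson-*-≤ true a = ≤-reflexive (+-identityʳ a)

sumFin≡∑ : ∀ n (f : Fin n → ℕ) → sumFin n f ≡ ∑[ i < n ] f i
sumFin≡∑ n f = trans (cong List.sum (map-tabulate id f)) (sum-tabulate n f)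
  where
  sum-tabulate : ∀ n (f : Fin n → ℕ) → List.sum (tabulate f) ≡ sum f
  sum-tabulate zero f = refl
  sum-tabulate (suc n) f = cong (f zero +_) (sum-tabulate n (f ∘ suc))

∑-mono-≤ : ∀ {n} {f g : Fin n → ℕ} → (∀ i → f i ≤ g i) → sum f ≤ sum g
∑-mono-≤ {zero} f≤g = z≤n
∑-mono-≤ {suc n} f≤g = +-mono-≤ (f≤g zero) (∑-mono-≤ (f≤g ∘ suc))

∑-δ : ∀ {n} (u : Fin n) (f : Fin n → ℕ) → ∑[ x < n ] (δ u x * f x) ≡ f u
∑-δ {suc n} zero f = begin
  f zero + 0 + ∑[ x < n ] 0 ≡⟨ cong (f zero + 0 +_) (sum-replicate-zero n) ⟩
  f zero + 0 + 0           ≡⟨ cong (_+ 0) (+-identityʳ (f zero)) ⟩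
  f zero + 0               ≡⟨ +-identityʳ (f zero) ⟩
  f zero                   ∎
  where open ≡-Reasoning
∑-δ {suc n} (suc u) f = trans (sum-cong-≗ (λ x → cong (_* f (suc x)) (δ-suc u x))) (∑-δ u (f ∘ suc))

∑-δ≡1 : ∀ {n} (u : Fin n) → ∑[ x < n ] δ u x ≡ 1
∑-δ≡1 u = trans (sum-cong-≗ (λ x → sym (*-identityʳ (δ u x)))) (∑-δ u (λ _ → 1))

term≤∑ : ∀ {n} (f : Fin n → ℕ) u → f u ≤ sum f
term≤∑ f u = subst (_≤ sum f) (∑-δ u f) (∑-mono-≤ (λ x → iverson-*-≤ ⌊ x ≟ u ⌋ (f x)))

two-terms≤∑ : ∀ {n} (f : Fin n → ℕ) {u v} → u ≢ v → f u + f v ≤ sum f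
two-terms≤∑ f {u} {v} u≢v =
  subst (_≤ sum f) (trans (∑-distrib-+ (λ x → δ u x * f x) (λ x → δ v x * f x)) (cong₂ _+_ (∑-δ u f) (∑-δ v f)))
        (∑-mono-≤ pointwise)
  where
  pointwise : ∀ x → δ u x * f x + δ v x * f x ≤ f x
  pointwise x with x ≟ u | x ≟ v
  ... | yes refl | yes refl = ⊥-elim (u≢v refl)
  ... | yes refl | no _     = ≤-reflexive (trans (+-identityʳ _) (+-identityʳ _))
  ... | no _     | yes refl = ≤-reflexive (+-identityʳ _)
  ... | no _     | no _     = z≤n

∑-1 : ∀ n → ∑[ i < n ] 1 ≡ n
∑-1 zero = refl
∑-1 (suc n) = cong suc (∑-1 n)

deg≡∑ : ∀ {n} (G : Graph n) x → deg G x ≡ ∑[ y < n ] iverson (G x y)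
deg≡∑ {n} G x = sumFin≡∑ n (λ y → iverson (G x y))

degSum≡∑ : ∀ {n} (G : Graph n) → degSum G ≡ ∑[ x < n ] deg G x
degSum≡∑ {n} G = sumFin≡∑ n (deg G)

degSqSum : ∀ {n} → Graph n → ℕ
degSqSum {n} G = sumFin n (λ x → deg G x * deg G x)

degSqSum≡∑ : ∀ {n} (G : Graph n) → degSqSum G ≡ ∑[ x < n ] (deg G x * deg G x)
degSqSum≡∑ {n} G = sumFin≡∑ n (λ x → deg G x * deg G x)

0<deg : ∀ {n} (G : Graph n) {x y} → Reach G x y → x ≢ y → 0 < deg G x
0<deg G here x≢x = ⊥-elim (x≢x refl)
0<deg G {x} (step {w = w} xw _) _ = begin
  1                             ≡⟨ cong iverson xw ⟨
  iverson (G x w)               ≤⟨ term≤∑ (λ y → iverson (G x y)) w ⟩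
  ∑[ y < _ ] iverson (G x y)   ≡⟨ deg≡∑ G x ⟨
  deg G x                       ∎
  where open ≤-Reasoning

order≤degSum : ∀ {k} (G : Graph (2 + k)) → Connected G → 2 + k ≤ degSum G
order≤degSum {k} G connected = begin
  2 + k                  ≡⟨ ∑-1 (2 + k) ⟨
  ∑[ x < 2 + k ] 1       ≤⟨ ∑-mono-≤ (λ x → 0<deg G (connected x (other x)) (≢-other x)) ⟩
  ∑[ x < 2 + k ] deg G x ≡⟨ degSum≡∑ G ⟨
  degSum G               ∎
  where
  open ≤-Reasoning
  other : Fin (2 + k) → Fin (2 + k)
  other zero = suc zero
  other (suc _) = zero
  ≢-other : ∀ x → x ≢ other x
  ≢-other zero ()
  ≢-other (suc _) ()

column≡deg : ∀ {n} {G : Graph n} → IsSimple G → ∀ u → ∑[ x < n ] iverson (G x u) ≡ deg G u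
column≡deg {G = G} simple u =
  trans (sum-cong-≗ (λ x → cong iverson (IsSimple.symmetric simple x u))) (sym (deg≡∑ G u))

module _ {n} {G : Graph n} (simple : IsSimple G) {u v : Fin n} (u≢v : u ≢ v) (uv∉G : G u v ≡ false) where
  open IsSimple simple

  vu∉G : G v u ≡ false
  vu∉G = trans (symmetric v u) uv∉G

  2*[deg+deg]≤degSum : 2 * (deg G u + deg G v) ≤ degSum G
  2*[deg+deg]≤degSum = begin
    2 * (du + dv)                   ≡⟨ cong (du + dv +_) (+-identityʳ (du + dv)) ⟩
    du + dv + (du + dv)             ≡⟨ ∑-incidences ⟨
    ∑[ x < n ] incidences x         ≤⟨ ∑-mono-≤ incidences≤deg ⟩
    ∑[ x < n ] deg G x              ≡⟨ degSum≡∑ G ⟨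
    degSum G                        ∎
    where
    open ≤-Reasoning
    du dv : ℕ
    du = deg G u
    dv = deg G v
    -- Vertex x is charged its edges to u and to v, and u, v are also charged their own degree;
    -- as u, v are distinct, nonadjacent and loopless, no vertex is charged more than its degree.
    incidences : Fin n → ℕ
    incidences x = iverson (G x u) + iverson (G x v) + (δ u x * du + δ v x * dv)

    ∑-incidences : ∑[ x < n ] incidences x ≡ du + dv + (du + dv)
    ∑-incidences = begin-equality
      ∑[ x < n ] incidences x
        ≡⟨ ∑-distrib-+ (λ x → iverson (G x u) + iverson (G x v)) (λ x → δ u x * du + δ v x * dv) ⟩
      ∑[ x < n ] (iverson (G x u) + iverson (G x v)) + ∑[ x < n ] (δ u x * du + δ v x * dv)
        ≡⟨ cong₂ _+_ (∑-distrib-+ (λ x → iverson (G x u)) (λ x → iverson (G x v)))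
                     (∑-distrib-+ (λ x → δ u x * du) (λ x → δ v x * dv)) ⟩
      ∑[ x < n ] iverson (G x u) + ∑[ x < n ] iverson (G x v) + (∑[ x < n ] (δ u x * du) + ∑[ x < n ] (δ v x * dv))
        ≡⟨ cong₂ _+_ (cong₂ _+_ (column≡deg simple u) (column≡deg simple v))
                     (cong₂ _+_ (∑-δ u (λ _ → du)) (∑-δ v (λ _ → dv))) ⟩
      du + dv + (du + dv)           ∎

    incidences≤deg : ∀ x → incidences x ≤ deg G x
    incidences≤deg x with x ≟ u | x ≟ v
    ... | yes refl | yes refl = ⊥-elim (u≢v refl)
    ... | yes refl | no _ rewrite irreflexive x | uv∉G = ≤-reflexive (trans (+-identityʳ _) (+-identityʳ _))
    ... | no _ | yes refl rewrite irreflexive x | vu∉G = ≤-reflexive (+-identityʳ _)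
    ... | no _ | no _ = begin
      iverson (G x u) + iverson (G x v) + 0 ≡⟨ +-identityʳ _ ⟩
      iverson (G x u) + iverson (G x v)     ≤⟨ two-terms≤∑ (λ y → iverson (G x y)) u≢v ⟩
      ∑[ y < n ] iverson (G x y)            ≡⟨ deg≡∑ G x ⟨
      deg G x                               ∎

  adjacency-addEdge : ∀ x y → iverson (addEdge G u v x y) ≡ iverson (G x y) + δ u x * δ v y + δ v x * δ u y
  adjacency-addEdge x y with x ≟ u | x ≟ v
  ... | yes refl | yes refl = ⊥-elim (u≢v refl)
  ... | yes refl | no _ with y ≟ v
  ...   | yes refl rewrite uv∉G = refl
  ...   | no _ = iverson-∨-false (G x y)
  adjacency-addEdge x y | no _ | yes refl with y ≟ u
  ...   | yes refl rewrite vu∉G = refl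
  ...   | no _ = iverson-∨-false (G x y)
  adjacency-addEdge x y | no _ | no _ = iverson-∨-false (G x y)

  deg-addEdge : ∀ x → deg (addEdge G u v) x ≡ deg G x + δ u x + δ v x
  deg-addEdge x = begin
    deg (addEdge G u v) x
      ≡⟨ deg≡∑ (addEdge G u v) x ⟩
    ∑[ y < n ] iverson (addEdge G u v x y)
      ≡⟨ sum-cong-≗ (adjacency-addEdge x) ⟩
    ∑[ y < n ] (iverson (G x y) + δ u x * δ v y + δ v x * δ u y)
      ≡⟨ ∑-distrib-+ (λ y → iverson (G x y) + δ u x * δ v y) (λ y → δ v x * δ u y) ⟩
    ∑[ y < n ] (iverson (G x y) + δ u x * δ v y) + ∑[ y < n ] (δ v x * δ u y)
      ≡⟨ cong (_+ ∑[ y < n ] (δ v x * δ u y)) (∑-distrib-+ (λ y → iverson (G x y)) (λ y → δ u x * δ v y)) ⟩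
    ∑[ y < n ] iverson (G x y) + ∑[ y < n ] (δ u x * δ v y) + ∑[ y < n ] (δ v x * δ u y)
      ≡⟨ cong₂ _+_ (cong₂ _+_ (deg≡∑ G x) (*-distribˡ-sum (δ u x) (δ v))) (*-distribˡ-sum (δ v x) (δ u)) ⟨
    deg G x + δ u x * ∑[ y < n ] δ v y + δ v x * ∑[ y < n ] δ u y
      ≡⟨ cong₂ (λ a b → deg G x + δ u x * a + δ v x * b) (∑-δ≡1 v) (∑-δ≡1 u) ⟩
    deg G x + δ u x * 1 + δ v x * 1
      ≡⟨ cong₂ (λ a b → deg G x + a + b) (*-identityʳ (δ u x)) (*-identityʳ (δ v x)) ⟩
    deg G x + δ u x + δ v x
      ∎
    where open ≡-Reasoning

  degSum-addEdge : degSum (addEdge G u v) ≡ 2 + degSum G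
  degSum-addEdge = begin
    degSum (addEdge G u v)                  ≡⟨ degSum≡∑ (addEdge G u v) ⟩
    ∑[ x < n ] deg (addEdge G u v) x        ≡⟨ sum-cong-≗ deg-addEdge ⟩
    ∑[ x < n ] (deg G x + δ u x + δ v x)    ≡⟨ ∑-distrib-+ (λ x → deg G x + δ u x) (δ v) ⟩
    ∑[ x < n ] (deg G x + δ u x) + ∑[ x < n ] δ v x
      ≡⟨ cong₂ _+_ (∑-distrib-+ (deg G) (δ u)) (∑-δ≡1 v) ⟩
    ∑[ x < n ] deg G x + ∑[ x < n ] δ u x + 1
      ≡⟨ cong₂ (λ a b → a + b + 1) (degSum≡∑ G) (sym (∑-δ≡1 u)) ⟨
    degSum G + 1 + 1                        ≡⟨ trans (+-assoc (degSum G) 1 1) (+-comm (degSum G) 2) ⟩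
    2 + degSum G                            ∎
    where open ≡-Reasoning

  degSqSum-addEdge : degSqSum (addEdge G u v) ≡ degSqSum G + (2 * deg G u + 1) + (2 * deg G v + 1)
  degSqSum-addEdge = begin
    degSqSum (addEdge G u v)                                  ≡⟨ degSqSum≡∑ (addEdge G u v) ⟩
    ∑[ x < n ] (deg (addEdge G u v) x * deg (addEdge G u v) x)
      ≡⟨ sum-cong-≗ (λ x → cong₂ _*_ (deg-addEdge x) (deg-addEdge x)) ⟩
    ∑[ x < n ] ((deg G x + δ u x + δ v x) * (deg G x + δ u x + δ v x)) ≡⟨ sum-cong-≗ square-expansion ⟩
    ∑[ x < n ] (deg G x * deg G x + δ u x * f x + δ v x * f x)
      ≡⟨ ∑-distrib-+ (λ x → deg G x * deg G x + δ u x * f x) (λ x → δ v x * f x) ⟩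
    ∑[ x < n ] (deg G x * deg G x + δ u x * f x) + ∑[ x < n ] (δ v x * f x)
      ≡⟨ cong₂ _+_ (∑-distrib-+ (λ x → deg G x * deg G x) (λ x → δ u x * f x)) (∑-δ v f) ⟩
    ∑[ x < n ] (deg G x * deg G x) + ∑[ x < n ] (δ u x * f x) + f v
      ≡⟨ cong₂ (λ a b → a + b + f v) (degSqSum≡∑ G) (sym (∑-δ u f)) ⟨
    degSqSum G + f u + f v                                    ∎
    where
    open ≡-Reasoning
    f : Fin n → ℕ
    f x = 2 * deg G x + 1
    at-u : ∀ d → (d + 1 + 0) * (d + 1 + 0) ≡ d * d + 1 * (2 * d + 1) + 0 * (2 * d + 1)
    at-u = solve-∀
    at-v : ∀ d → (d + 0 + 1) * (d + 0 + 1) ≡ d * d + 0 * (2 * d + 1) + 1 * (2 * d + 1)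
    at-v = solve-∀
    elsewhere : ∀ d → (d + 0 + 0) * (d + 0 + 0) ≡ d * d + 0 * (2 * d + 1) + 0 * (2 * d + 1)
    elsewhere = solve-∀
    square-expansion : ∀ x → (deg G x + δ u x + δ v x) * (deg G x + δ u x + δ v x)
                           ≡ deg G x * deg G x + δ u x * f x + δ v x * f x
    square-expansion x with x ≟ u | x ≟ v
    ... | yes refl | yes refl = ⊥-elim (u≢v refl)
    ... | yes refl | no _ = at-u (deg G x)
    ... | no _ | yes refl = at-v (deg G x)
    ... | no _ | no _ = elsewhere (deg G x)

deg-star-centre : ∀ m → deg (star m) zero ≡ m
deg-star-centre m = trans (deg≡∑ (star m) zero) (∑-1 m)

deg-star-leaf : ∀ m (i : Fin m) → deg (star m) (suc i) ≡ 1
deg-star-leaf m i = trans (deg≡∑ (star m) (suc i)) (cong suc (sum-replicate-zero m))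

degSum-star : ∀ m → degSum (star m) ≡ m + m
degSum-star m = trans (degSum≡∑ (star m))
  (cong₂ _+_ (deg-star-centre m) (trans (sum-cong-≗ (deg-star-leaf m)) (∑-1 m)))

degSqSum-star : ∀ m → degSqSum (star m) ≡ m * m + m
degSqSum-star m = trans (degSqSum≡∑ (star m))
  (cong₂ _+_ (cong₂ _*_ (deg-star-centre m) (deg-star-centre m))
             (trans (sum-cong-≗ (λ i → cong₂ _*_ (deg-star-leaf m i) (deg-star-leaf m i))) (∑-1 m)))

-- fromℚᵘ (mkℚᵘ a b) is a / suc b by definition, so toℚᵘ-fromℚᵘ trades a normalised fraction
-- for the unnormalised one, whose order is plain cross-multiplication.
/≤/⇒*≤* : ∀ a b c d .{{_ : NonZero b}} .{{_ : NonZero d}} → ℤ.+ a / b ℚ.≤ ℤ.+ c / d → a * d ≤ c * b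
/≤/⇒*≤* a (suc b) c (suc d) a/b≤c/d
  with ≤-respʳ-≃ (toℚᵘ-fromℚᵘ (mkℚᵘ (ℤ.+ c) d))
         (≤-respˡ-≃ (toℚᵘ-fromℚᵘ (mkℚᵘ (ℤ.+ a) b)) (toℚᵘ-mono-≤ a/b≤c/d))
... | *≤* ad≤cb = drop‿+≤+ (subst₂ ℤ._≤_ (sym (pos-* a (suc d))) (sym (pos-* c (suc b))) ad≤cb)

*<*⇒/</ : ∀ a b c d .{{_ : NonZero b}} .{{_ : NonZero d}} → a * d < c * b → ℤ.+ a / b ℚ.< ℤ.+ c / d
*<*⇒/</ a (suc b) c (suc d) ad<cb = toℚᵘ-cancel-<
  (<-respˡ-≃ (≃-sym (toℚᵘ-fromℚᵘ (mkℚᵘ (ℤ.+ a) b)))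
    (<-respʳ-≃ (≃-sym (toℚᵘ-fromℚᵘ (mkℚᵘ (ℤ.+ c) d)))
      (*<* (subst₂ ℤ._<_ (pos-* a (suc d)) (pos-* c (suc b)) (ℤ.+<+ ad<cb)))))

-- tr2 unfolds only at a successor degree sum, which also rules out its junk value at 0.
tr2≤tr2⇒ : ∀ {n n′} (G : Graph n) (H : Graph n′) {k l} → degSum G ≡ suc k → degSum H ≡ suc l →
           tr2 G ℚ.≤ tr2 H → (degSqSum G + suc k) * (suc l * suc l) ≤ (degSqSum H + suc l) * (suc k * suc k)
tr2≤tr2⇒ G H DG≡1+k DH≡1+l with degSum G | DG≡1+k | degSum H | DH≡1+l
... | suc k | refl | suc l | refl =
  /≤/⇒*≤* (degSqSum G + suc k) (suc k * suc k) (degSqSum H + suc l) (suc l * suc l)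

tr2<tr2⇐ : ∀ {n n′} (G : Graph n) (H : Graph n′) {k l} → degSum G ≡ suc k → degSum H ≡ suc l →
           (degSqSum G + suc k) * (suc l * suc l) < (degSqSum H + suc l) * (suc k * suc k) → tr2 G ℚ.< tr2 H
tr2<tr2⇐ G H DG≡1+k DH≡1+l with degSum G | DG≡1+k | degSum H | DH≡1+l
... | suc k | refl | suc l | refl =
  *<*⇒/</ (degSqSum G + suc k) (suc k * suc k) (degSqSum H + suc l) (suc l * suc l)

tr2-star-num tr2-star-den : ℕ → ℕ
tr2-star-num m = m * m + m + (m + m)
tr2-star-den m = (m + m) * (m + m)

tr2≤tr2-star⇒ : ∀ {n} (G : Graph n) m {k} → degSum G ≡ suc k → tr2 G ℚ.≤ tr2 (star (suc m)) →
                (degSqSum G + suc k) * tr2-star-den (suc m) ≤ tr2-star-num (suc m) * (suc k * suc k)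
tr2≤tr2-star⇒ G m {k} D≡1+k tr₂G≤tr₂star =
  subst (λ s → (degSqSum G + suc k) * tr2-star-den (suc m) ≤ (s + (suc m + suc m)) * (suc k * suc k))
        (degSqSum-star (suc m)) (tr2≤tr2⇒ G (star (suc m)) D≡1+k (degSum-star (suc m)) tr₂G≤tr₂star)

tr2<tr2-star⇐ : ∀ {n} (G : Graph n) m {k} → degSum G ≡ suc k →
                (degSqSum G + suc k) * tr2-star-den (suc m) < tr2-star-num (suc m) * (suc k * suc k) →
                tr2 G ℚ.< tr2 (star (suc m))
tr2<tr2-star⇐ G m {k} D≡1+k cross =
  tr2<tr2⇐ G (star (suc m)) D≡1+k (degSum-star (suc m))
    (subst (λ s → (degSqSum G + suc k) * tr2-star-den (suc m) < (s + (suc m + suc m)) * (suc k * suc k))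
           (sym (degSqSum-star (suc m))) cross)

star-increment : ∀ m a D .{{_ : NonZero m}} → 2 * a ≤ D → m ≤ D →
                 (2 * a + 4) * tr2-star-den m < tr2-star-num m * (4 * D + 4)
-- With D = 2a + r: P (4D + 4) − (2a + 4) Q = 4m (mr + 3D + 3) − 12m², positive as m ≤ D.
star-increment m a _ 2a≤D m≤D with m≤n⇒∃[o]m+o≡n 2a≤D
... | r , refl = +-cancelʳ-< (4 * (m * (3 * m))) _ _ (begin-strict
  (2 * a + 4) * Q + 4 * (m * (3 * m))               <⟨ +-monoʳ-< ((2 * a + 4) * Q) (*-monoʳ-< 4 (*-monoʳ-< m 3m<)) ⟩
  (2 * a + 4) * Q + 4 * (m * (m * r + (3 * D + 3))) ≡⟨ identity m a r ⟩
  P * (4 * D + 4) + 4 * (m * (3 * m))               ∎)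
  where
  open ≤-Reasoning
  D P Q : ℕ
  D = 2 * a + r
  P = tr2-star-num m
  Q = tr2-star-den m
  3m< : 3 * m < m * r + (3 * D + 3)
  3m< = begin-strict
    3 * m               ≤⟨ *-monoʳ-≤ 3 m≤D ⟩
    3 * D               <⟨ m<m+n (3 * D) z<s ⟩
    3 * D + 3           ≤⟨ m≤n+m (3 * D + 3) (m * r) ⟩
    m * r + (3 * D + 3) ∎
  identity : ∀ m a r → (2 * a + 4) * ((m + m) * (m + m)) + 4 * (m * (m * r + (3 * (2 * a + r) + 3)))
                     ≡ (m * m + m + (m + m)) * (4 * (2 * a + r) + 4) + 4 * (m * (3 * m))
  identity = solve-∀

mediant-step : ∀ S D du dv P Q → (S + D) * Q ≤ P * (D * D) → (2 * (du + dv) + 4) * Q < P * (4 * D + 4) →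
               (S + (2 * du + 1) + (2 * dv + 1) + (2 + D)) * Q < P * ((2 + D) * (2 + D))
mediant-step S D du dv P Q old new = subst₂ _<_ (split-left S D du dv Q) (split-right P D) (+-mono-≤-< old new)
  where
  split-left : ∀ S D du dv Q → (S + D) * Q + (2 * (du + dv) + 4) * Q
                             ≡ (S + (2 * du + 1) + (2 * dv + 1) + (2 + D)) * Q
  split-left = solve-∀
  split-right : ∀ P D → P * (D * D) + P * (4 * D + 4) ≡ P * ((2 + D) * (2 + D))
  split-right = solve-∀

lemma3p7 : (m : ℕ) → 1 ≤ m → (G : Graph (suc m)) → IsSimple G → Connected G →
    (u v : Fin (suc m)) → ¬ (u ≡ v) → G u v ≡ false →
    tr2 G ℚ.≤ tr2 (star m) → tr2 (addEdge G u v) ℚ.< tr2 (star m)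
lemma3p7 (suc m) _ G simple connected u v u≢v uv∉G tr₂G≤tr₂star =
  tr2<tr2-star⇐ (addEdge G u v) m (trans (degSum-addEdge simple u≢v uv∉G) (cong (2 +_) D≡1+k))
    (subst (λ s → (s + (2 + suc k)) * Q < P * ((2 + suc k) * (2 + suc k))) (sym (degSqSum-addEdge simple u≢v uv∉G))
           (mediant-step (degSqSum G) (suc k) du dv P Q old new))
  where
  du dv k P Q : ℕ
  du = deg G u
  dv = deg G v
  P = tr2-star-num (suc m)
  Q = tr2-star-den (suc m)

  n≤D : 2 + m ≤ degSum G
  n≤D = order≤degSum G connected
  k = pred (degSum G)
  D≡1+k : degSum G ≡ suc k
  D≡1+k = sym (suc-pred (degSum G) {{>-nonZero (<-≤-trans z<s n≤D)}})

  old : (degSqSum G + suc k) * Q ≤ P * (suc k * suc k)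
  old = tr2≤tr2-star⇒ G m D≡1+k tr₂G≤tr₂star

  new : (2 * (du + dv) + 4) * Q < P * (4 * suc k + 4)
  new = star-increment (suc m) (du + dv) (suc k)
          (subst (2 * (du + dv) ≤_) D≡1+k (2*[deg+deg]≤degSum simple u≢v uv∉G))
          (subst (suc m ≤_) D≡1+k (<⇒≤ n≤D))
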